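{- Let $n$ and $g$ be integers with $n\geq 4$ and $n-2\leq g\leq n-1$. Then $t_g(LTQ_n)\leq 2^{n-1}-1$ both under the PMC model and under the MM$^*$ model.
   Context: The locally twisted cube $LTQ_n$ ($n\ge 2$) has vertex set $\{0,1\}^n$, vertices written $u=u_{n-1}\ldots u_1u_0$. Two vertices $u,v$ are adjacent iff either (1) there is $k$ with $2\le k\le n-1$ such that $u_k=\overline{v_k}$, $u_{k-1}=v_{k-1}\oplus u_0$ (addition mod 2), and all remaining bits agree; or (2) $u_k=\overline{v_k}$ for some $k\in\{0,1\}$ and $u_r=v_r$ for all $r=2,\ldots,n-1$. PMC model: for $G=(V,E)$ and faulty set $F$, each vertex $u$ tests each neighbor $v$ with outcome $0$ if $u,v\notin F$, $1$ if $u\notin F$, $v\in F$, arbitrary if $u\in F$. MM$^*$ model: each vertex $w$ compares every pair $\{u,v\}$ of its distinct neighbors, outcome $0$ if $u,v,w\notin F$, $1$ if $w\notin F$ and $\{u,v\}\cap F\ne\emptyset$, arbitrary if $w\in F$. In either model, $\sigma(F)$ is the set of syndromes (collections of all outcomes) producible by $F$, and distinct $F_1,F_2$ are distinguishable iff $\sigma(F_1)\cap\sigma(F_2)=\emptyset$. A set $F\subseteq V$ is a $g$-good-neighbor conditional faulty set if every $v\in V\setminus F$ has at least $g$ neighbors in $V\setminus F$. $t_g(G)$ (in a given model) is the maximum $t$ such that every two distinct $g$-good-neighbor conditional faulty sets of size at most $t$ are distinguishable in that model. -}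

module Defs where

open import Data.Bool using (Bool; true; false; not; _∨_; _xor_)
open import Data.Nat using (ℕ; zero; suc; _≤_; _<_; _∸_)
open import Data.Vec using (Vec; []; _∷_)
open import Data.List using (List; []; _∷_; _++_; map; length; filterᵇ)
open import Data.List.Relation.Unary.All using (All)
open import Data.List.Relation.Unary.Unique.Propositional using (Unique)
open import Data.Product using (Σ; ∃; _×_)
open import Data.Sum using (_⊎_)
open import Data.Empty using (⊥)
open import Relation.Nullary using (¬_)
open import Relation.Binary.PropositionalEquality using (_≡_; _≢_)

-- Vertices of LTQ_n: bit strings of length n.  The head of the vector is
-- bit u_0, the next entry u_1, ..., the last entry u_{n-1}.
Vertex : ℕ → Set
Vertex n = Vec Bool n

-- bit u r = u_r  (false outside the range r < n; only used for r < n)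
bit : ∀ {n} → Vertex n → ℕ → Bool
bit []       _       = false
bit (b ∷ bs) zero    = b
bit (b ∷ bs) (suc r) = bit bs r

Adj : (n : ℕ) → Vertex n → Vertex n → Set
Adj n u v =
  (∃ λ k → 2 ≤ k × k < n
     × bit u k ≡ not (bit v k)
     × bit u (k ∸ 1) ≡ (bit v (k ∸ 1) xor bit u 0)
     × (∀ r → r < n → r ≢ k → r ≢ k ∸ 1 → bit u r ≡ bit v r))
  ⊎
  (∃ λ k → k < 2 × k < n
     × bit u k ≡ not (bit v k)
     × (∀ r → r < n → r ≢ k → bit u r ≡ bit v r))

allVertices : (n : ℕ) → List (Vertex n)
allVertices zero    = [] ∷ []
allVertices (suc n) = map (false ∷_) (allVertices n) ++ map (true ∷_) (allVertices n)

-- a (faulty) vertex set, as its characteristic function (true = faulty)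
VSet : ℕ → Set
VSet n = Vertex n → Bool

size : ∀ {n} → VSet n → ℕ
size {n} F = length (filterᵇ F (allVertices n))

Distinct : ∀ {n} → VSet n → VSet n → Set
Distinct F F' = ∃ λ v → F v ≢ F' v

HasGoodNeighbours : (n g : ℕ) → VSet n → Vertex n → Set
HasGoodNeighbours n g F v =
  ∃ λ (ws : List (Vertex n)) → length ws ≡ g × Unique ws
    × All (λ w → Adj n v w × F w ≡ false) ws

GoodNeighborFaulty : (n g : ℕ) → VSet n → Set
GoodNeighborFaulty n g F = ∀ v → F v ≡ false → HasGoodNeighbours n g F v

record Model (n : ℕ) : Set₁ where
  field
    Syndrome : Set
    _∈σ_     : Syndrome → VSet n → Set

-- A syndrome assigns an outcome (true = 1) to each test (u,v);
-- it is stored as a total function, entries for non-adjacent pairs are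
-- unconstrained padding (irrelevant for distinguishability).
PMC : (n : ℕ) → Model n
PMC n = record
  { Syndrome = Vertex n → Vertex n → Bool
  ; _∈σ_ = λ s F → ∀ u v → Adj n u v → F u ≡ false → s u v ≡ F v
  }

-- MM* model.  s w u v is the outcome of w comparing {u,v}; the comparison
-- is of an unordered pair, so syndromes are symmetric in u,v.
MMstar : (n : ℕ) → Model n
MMstar n = record
  { Syndrome = Vertex n → Vertex n → Vertex n → Bool
  ; _∈σ_ = λ s F → (∀ w u v → s w u v ≡ s w v u)
                 × (∀ w u v → Adj n w u → Adj n w v → u ≢ v → F w ≡ false
                       → s w u v ≡ (F u ∨ F v))
  }

Distinguishable : ∀ {n} → Model n → VSet n → VSet n → Set
Distinguishable M F₁ F₂ = ¬ (Σ Syndrome λ s → (s ∈σ F₁) × (s ∈σ F₂))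
  where open Model M

GoodNeighborDiagnosable : ∀ {n} → Model n → ℕ → ℕ → Set
GoodNeighborDiagnosable {n} M g t =
  ∀ F₁ F₂ → GoodNeighborFaulty n g F₁ → GoodNeighborFaulty n g F₂
    → size F₁ ≤ t → size F₂ ≤ t → Distinct F₁ F₂ → Distinguishable M F₁ F₂

-- t_g(LTQ_n) ≤ T in model M : every t with the above property is ≤ T
-- (t_g is the maximum such t).
tg≤ : ∀ {n} → Model n → ℕ → ℕ → Set
tg≤ M g T = ∀ t → GoodNeighborDiagnosable M g t → t ≤ T

-- Split LTQ_n by the bit u_0 into F = {u | u_0 = 1} and its complement.  Every
-- dimension k ≥ 1 keeps u_0 fixed, so each vertex has n-1 neighbours in its own
-- half, and both halves are (n-1)-good-neighbour faulty sets of size 2^(n-1).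
-- Two complementary fault sets can never be told apart: a syndrome in which
-- every vertex reports the set it is fault-free in is produced by both.
-- Hence no t ≥ 2^(n-1) is diagnosable.
module Submission where

open import Defs
open import Data.Bool using (Bool; true; false; not; _∨_; _xor_; T; if_then_else_)
open import Data.Bool.Properties
  using (T?; not-involutive; not-¬; ∨-comm; xor-comm; xor-assoc; xor-same; xor-identityʳ)
open import Data.Empty using (⊥-elim)
open import Data.Fin using (Fin; toℕ)
open import Data.Fin.Properties using (toℕ-injective; toℕ<n)
open import Data.List using (List; _++_; map; length; filterᵇ; take; tabulate)
open import Data.List.Properties
  using (length-take; length-tabulate; length-++; length-map; filter-++; filter-all; filter-none)
open import Data.List.Relation.Unary.All using (All; universal)
import Data.List.Relation.Unary.All.Properties as All
open import Data.List.Relation.Unary.Unique.Propositional using (Unique)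
import Data.List.Relation.Unary.Unique.Propositional.Properties as Unique
open import Data.Nat using (ℕ; zero; suc; pred; _+_; _∸_; _^_; _⊓_; _≤_; _<_; z≤n; s≤s; _≤?_)
open import Data.Nat.Properties
  using (<-cmp; <-trans; ≤-trans; ≤-<-trans; <⇒≢; >⇒≢; n<1+n; pred[n]≤n; ≰⇒>; m≤n⇒m⊓n≡m; m≤n+m∸n; +-identityʳ)
open import Data.Product using (_×_; _,_)
open import Data.Sum using (inj₁; inj₂)
open import Data.Vec using (Vec; []; _∷_; replicate)
open import Data.Vec.Properties using (∷-injectiveʳ)
open import Function using (_∘_)
open import Relation.Binary using (tri<; tri≈; tri>)
open import Relation.Binary.PropositionalEquality using (_≡_; _≢_; refl; sym; trans; cong; cong₂; subst; module ≡-Reasoning)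
open import Relation.Nullary using (¬_; yes; no)

flipAt : ∀ {m} → ℕ → Vec Bool m → Vec Bool m
flipAt j       []      = []
flipAt zero    (x ∷ w) = not x ∷ w
flipAt (suc j) (x ∷ w) = x ∷ flipAt j w

bit-flipAt-≢ : ∀ {m} j r (w : Vec Bool m) → r ≢ j → bit (flipAt j w) r ≡ bit w r
bit-flipAt-≢ j       r       []      r≢j = refl
bit-flipAt-≢ zero    zero    (x ∷ w) r≢j = ⊥-elim (r≢j refl)
bit-flipAt-≢ zero    (suc r) (x ∷ w) r≢j = refl
bit-flipAt-≢ (suc j) zero    (x ∷ w) r≢j = refl
bit-flipAt-≢ (suc j) (suc r) (x ∷ w) r≢j = bit-flipAt-≢ j r w (r≢j ∘ cong suc)

bit-flipAt-≡ : ∀ {m} j (w : Vec Bool m) → j < m → bit (flipAt j w) j ≡ not (bit w j)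
bit-flipAt-≡ zero    (x ∷ w) _       = refl
bit-flipAt-≡ (suc j) (x ∷ w) (s≤s j<m) = bit-flipAt-≡ j w j<m

-- b ∷ twist b j w is the neighbour of b ∷ w in dimension k = j + 1 (tail index j
-- is bit u_(j+1)); for k ≥ 2 the extra flip at tail index j - 1 realises
-- u_(k-1) = v_(k-1) ⊕ u_0 when u_0 = b = 1.
twist : ∀ {m} → Bool → ℕ → Vec Bool m → Vec Bool m
twist b     zero    w = flipAt 0 w
twist false (suc j) w = flipAt (suc j) w
twist true  (suc j) w = flipAt j (flipAt (suc j) w)

bit-twist-other : ∀ {m} b j r (w : Vec Bool m) → r ≢ j → r ≢ pred j → bit (twist b j w) r ≡ bit w r
bit-twist-other b     zero    r w r≢j _     = bit-flipAt-≢ 0 r w r≢j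
bit-twist-other false (suc j) r w r≢j _     = bit-flipAt-≢ (suc j) r w r≢j
bit-twist-other true  (suc j) r w r≢j r≢pj =
  trans (bit-flipAt-≢ j r (flipAt (suc j) w) r≢pj) (bit-flipAt-≢ (suc j) r w r≢j)

bit-twist-self : ∀ {m} b j (w : Vec Bool m) → j < m → bit (twist b j w) j ≡ not (bit w j)
bit-twist-self b     zero    w j<m = bit-flipAt-≡ 0 w j<m
bit-twist-self false (suc j) w j<m = bit-flipAt-≡ (suc j) w j<m
bit-twist-self true  (suc j) w j<m =
  trans (bit-flipAt-≢ j (suc j) (flipAt (suc j) w) (>⇒≢ (n<1+n j))) (bit-flipAt-≡ (suc j) w j<m)

bit-twist-self′ : ∀ {m} b j (w : Vec Bool m) → j < m → bit w j ≡ not (bit (twist b j w) j)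
bit-twist-self′ b j w j<m = trans (sym (not-involutive _)) (cong not (sym (bit-twist-self b j w j<m)))

bit-twist-pred : ∀ {m} b j (w : Vec Bool m) → j < m → bit (twist b (suc j) w) j ≡ bit w j xor b
bit-twist-pred false j w _   = trans (bit-flipAt-≢ (suc j) j w (<⇒≢ (n<1+n j))) (sym (xor-identityʳ _))
bit-twist-pred true  j w j<m = begin
  bit (flipAt j (flipAt (suc j) w)) j ≡⟨ bit-flipAt-≡ j (flipAt (suc j) w) j<m ⟩
  not (bit (flipAt (suc j) w) j)      ≡⟨ cong not (bit-flipAt-≢ (suc j) j w (<⇒≢ (n<1+n j))) ⟩
  not (bit w j)                       ≡⟨ xor-comm true (bit w j) ⟩
  bit w j xor true                    ∎
  where open ≡-Reasoning

twist-injective : ∀ {m} b (w : Vec Bool m) {i j} → i < j → j < m → twist b i w ≢ twist b j w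
twist-injective b w {i} {j} i<j j<m eq = not-¬ unchanged flipped
  where
  unchanged : bit (twist b j w) j ≡ bit w j
  unchanged = trans (cong (λ v → bit v j) (sym eq))
                    (bit-twist-other b i j w (>⇒≢ i<j) (>⇒≢ (≤-<-trans pred[n]≤n i<j)))
  flipped : bit (twist b j w) j ≡ not (bit w j)
  flipped = bit-twist-self b j w j<m

twist-adjacent : ∀ {m} b j (w : Vec Bool m) → j < m → Adj (suc m) (b ∷ w) (b ∷ twist b j w)
twist-adjacent b zero    w 0<m = inj₂ (1 , s≤s (s≤s z≤n) , s≤s 0<m , bit-twist-self′ b 0 w 0<m , others)
  where
  others : ∀ r → r < suc _ → r ≢ 1 → bit (b ∷ w) r ≡ bit (b ∷ twist b 0 w) r
  others zero    _ _   = refl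
  others (suc r) _ r≢1 = sym (bit-twist-other b 0 r w (r≢1 ∘ cong suc) (r≢1 ∘ cong suc))
twist-adjacent b (suc j) w j<m =
  inj₁ (suc (suc j) , s≤s (s≤s z≤n) , s≤s j<m , bit-twist-self′ b (suc j) w j<m , twisted , others)
  where
  twisted : bit w j ≡ bit (twist b (suc j) w) j xor b
  twisted = begin
    bit w j                   ≡⟨ sym (xor-identityʳ _) ⟩
    bit w j xor false         ≡⟨ cong (bit w j xor_) (sym (xor-same b)) ⟩
    bit w j xor (b xor b)     ≡⟨ sym (xor-assoc (bit w j) b b) ⟩
    (bit w j xor b) xor b     ≡⟨ cong (_xor b) (sym (bit-twist-pred b j w (<-trans (n<1+n j) j<m))) ⟩
    bit (twist b (suc j) w) j xor b ∎
    where open ≡-Reasoning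
  others : ∀ r → r < suc _ → r ≢ suc (suc j) → r ≢ suc j → bit (b ∷ w) r ≡ bit (b ∷ twist b (suc j) w) r
  others zero    _ _    _    = refl
  others (suc r) _ r≢k r≢k-1 = sym (bit-twist-other b (suc j) r w (r≢k ∘ cong suc) (r≢k-1 ∘ cong suc))

sameHalfNeighbour : ∀ {m} → Vertex (suc m) → Fin m → Vertex (suc m)
sameHalfNeighbour (b ∷ w) i = b ∷ twist b (toℕ i) w

sameHalfNeighbour-injective : ∀ {m} (v : Vertex (suc m)) {i j : Fin m}
  → sameHalfNeighbour v i ≡ sameHalfNeighbour v j → i ≡ j
sameHalfNeighbour-injective (b ∷ w) {i} {j} eq with <-cmp (toℕ i) (toℕ j)
... | tri< i<j _ _ = ⊥-elim (twist-injective b w i<j (toℕ<n j) (∷-injectiveʳ eq))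
... | tri≈ _ i≡j _ = toℕ-injective i≡j
... | tri> _ _ j<i = ⊥-elim (twist-injective b w j<i (toℕ<n i) (sym (∷-injectiveʳ eq)))

ConstantOnHalves : ∀ {m} → VSet (suc m) → Set
ConstantOnHalves F = ∀ b w w′ → F (b ∷ w) ≡ F (b ∷ w′)

constantOnHalves-goodNeighborFaulty : ∀ {m} g → g ≤ m → (F : VSet (suc m))
  → ConstantOnHalves F → GoodNeighborFaulty (suc m) g F
constantOnHalves-goodNeighborFaulty {m} g g≤m F const v@(b ∷ w) Fv≡false =
  take g neighbours , length≡g , Unique.take⁺ g unique , All.take⁺ g goodAll
  where
  neighbours : List (Vertex (suc m))
  neighbours = tabulate (sameHalfNeighbour v)
  length≡g : length (take g neighbours) ≡ g
  length≡g = begin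
    length (take g neighbours) ≡⟨ length-take g neighbours ⟩
    g ⊓ length neighbours      ≡⟨ cong (g ⊓_) (length-tabulate (sameHalfNeighbour v)) ⟩
    g ⊓ m                      ≡⟨ m≤n⇒m⊓n≡m g≤m ⟩
    g                          ∎
    where open ≡-Reasoning
  unique : Unique (tabulate (sameHalfNeighbour v))
  unique = Unique.tabulate⁺ (sameHalfNeighbour-injective v)
  goodAll : All (λ u → Adj (suc m) v u × F u ≡ false) neighbours
  goodAll = All.tabulate⁺ λ i →
    twist-adjacent b (toℕ i) w (toℕ<n i) , trans (const b _ w) Fv≡false

complement : ∀ {n} → VSet n → VSet n
complement F v = not (F v)

complement-distinct : ∀ {n} (F : VSet n) → Distinct F (complement F)
complement-distinct {n} F = replicate n false , not-¬ refl

complement-indistinguishable-PMC : ∀ {n} (F : VSet n) → ¬ Distinguishable (PMC n) F (complement F)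
complement-indistinguishable-PMC {n} F distinguishable = distinguishable (s , s∈σF , s∈σF′)
  where
  s : Vertex n → Vertex n → Bool
  s u v = if F u then not (F v) else F v
  s∈σF : ∀ u v → Adj n u v → F u ≡ false → s u v ≡ F v
  s∈σF u v _ Fu≡false rewrite Fu≡false = refl
  s∈σF′ : ∀ u v → Adj n u v → not (F u) ≡ false → s u v ≡ not (F v)
  s∈σF′ u v _ F′u≡false with F u
  ... | true = refl
  s∈σF′ u v _ () | false

complement-indistinguishable-MMstar : ∀ {n} (F : VSet n) → ¬ Distinguishable (MMstar n) F (complement F)
complement-indistinguishable-MMstar {n} F distinguishable =
  distinguishable (s , (s-sym , s∈σF) , (s-sym , s∈σF′))
  where
  s : Vertex n → Vertex n → Vertex n → Bool
  s w u v = if F w then not (F u) ∨ not (F v) else F u ∨ F v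
  s-sym : ∀ w u v → s w u v ≡ s w v u
  s-sym w u v with F w
  ... | true  = ∨-comm (not (F u)) (not (F v))
  ... | false = ∨-comm (F u) (F v)
  s∈σF : ∀ w u v → Adj n w u → Adj n w v → u ≢ v → F w ≡ false → s w u v ≡ (F u ∨ F v)
  s∈σF w u v _ _ _ Fw≡false rewrite Fw≡false = refl
  s∈σF′ : ∀ w u v → Adj n w u → Adj n w v → u ≢ v → not (F w) ≡ false
    → s w u v ≡ (not (F u) ∨ not (F v))
  s∈σF′ w u v _ _ _ F′w≡false with F w
  ... | true = refl
  s∈σF′ w u v _ _ _ () | false

length-allVertices : ∀ m → length (allVertices m) ≡ 2 ^ m
length-allVertices zero    = refl
length-allVertices (suc m) = begin
  length (map (false ∷_) vs ++ map (true ∷_) vs)  ≡⟨ length-++ (map (false ∷_) vs) ⟩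
  length (map (false ∷_) vs) + length (map (true ∷_) vs)
    ≡⟨ cong₂ _+_ (length-map (false ∷_) vs) (length-map (true ∷_) vs) ⟩
  length vs + length vs                            ≡⟨ cong (λ k → k + k) (length-allVertices m) ⟩
  2 ^ m + 2 ^ m                                    ≡⟨ cong (2 ^ m +_) (sym (+-identityʳ (2 ^ m))) ⟩
  2 ^ suc m                                        ∎
  where
  open ≡-Reasoning
  vs = allVertices m

size-byHalves : ∀ {m} (F : VSet (suc m)) → size F
  ≡ length (filterᵇ F (map (false ∷_) (allVertices m))) + length (filterᵇ F (map (true ∷_) (allVertices m)))
size-byHalves {m} F =
  trans (cong length (filter-++ (T? ∘ F) (map (false ∷_) (allVertices m)) _))
        (length-++ (filterᵇ F (map (false ∷_) (allVertices m))))

length-filterᵇ-map-all : ∀ {A B : Set} (p : B → Bool) (f : A → B) xs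
  → (∀ x → T (p (f x))) → length (filterᵇ p (map f xs)) ≡ length xs
length-filterᵇ-map-all p f xs pf =
  trans (cong length (filter-all (T? ∘ p) (All.map⁺ (universal pf xs)))) (length-map f xs)

length-filterᵇ-map-none : ∀ {A B : Set} (p : B → Bool) (f : A → B) xs
  → (∀ x → ¬ T (p (f x))) → length (filterᵇ p (map f xs)) ≡ 0
length-filterᵇ-map-none p f xs ¬pf = cong length (filter-none (T? ∘ p) (All.map⁺ (universal ¬pf xs)))

bit0Set : ∀ {m} → VSet (suc m)
bit0Set (b ∷ _) = b

size-bit0Set : ∀ m → size (bit0Set {m}) ≡ 2 ^ m
size-bit0Set m = trans (size-byHalves (bit0Set {m}))
  (cong₂ _+_ (length-filterᵇ-map-none bit0Set (false ∷_) (allVertices m) (λ _ ()))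
             (trans (length-filterᵇ-map-all bit0Set (true ∷_) (allVertices m) _) (length-allVertices m)))

size-complement-bit0Set : ∀ m → size (complement (bit0Set {m})) ≡ 2 ^ m
size-complement-bit0Set m = trans (size-byHalves (complement (bit0Set {m})))
  (trans (cong₂ _+_ (length-filterᵇ-map-all (complement bit0Set) (false ∷_) (allVertices m) _)
                    (length-filterᵇ-map-none (complement bit0Set) (true ∷_) (allVertices m) (λ _ ())))
         (trans (+-identityʳ _) (length-allVertices m)))

tg≤-of-indistinguishable : ∀ {n} (M : Model n) g T {F₁ F₂}
  → GoodNeighborFaulty n g F₁ → GoodNeighborFaulty n g F₂
  → size F₁ ≤ suc T → size F₂ ≤ suc T → Distinct F₁ F₂ → ¬ Distinguishable M F₁ F₂
  → tg≤ M g T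
tg≤-of-indistinguishable M g T good₁ good₂ size₁ size₂ distinct indistinguishable t diagnosable
  with t ≤? T
... | yes t≤T = t≤T
... | no  t≰T = ⊥-elim (indistinguishable
      (diagnosable _ _ good₁ good₂ (≤-trans size₁ (≰⇒> t≰T)) (≤-trans size₂ (≰⇒> t≰T)) distinct))

lemma11 : (n g : ℕ) → 4 ≤ n → n ∸ 2 ≤ g → g ≤ n ∸ 1
        → tg≤ (PMC n) g (2 ^ (n ∸ 1) ∸ 1) × tg≤ (MMstar n) g (2 ^ (n ∸ 1) ∸ 1)
lemma11 (suc m) g _ _ g≤m =
  bound (PMC (suc m)) (complement-indistinguishable-PMC bit0Set) ,
  bound (MMstar (suc m)) (complement-indistinguishable-MMstar bit0Set)
  where
  halfSize≤ : 2 ^ m ≤ suc (2 ^ m ∸ 1)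
  halfSize≤ = m≤n+m∸n (2 ^ m) 1
  bound : (M : Model (suc m)) → ¬ Distinguishable M bit0Set (complement bit0Set) → tg≤ M g (2 ^ m ∸ 1)
  bound M = tg≤-of-indistinguishable M g (2 ^ m ∸ 1)
    (constantOnHalves-goodNeighborFaulty g g≤m bit0Set (λ _ _ _ → refl))
    (constantOnHalves-goodNeighborFaulty g g≤m (complement bit0Set) (λ _ _ _ → refl))
    (subst (_≤ suc (2 ^ m ∸ 1)) (sym (size-bit0Set m)) halfSize≤)
    (subst (_≤ suc (2 ^ m ∸ 1)) (sym (size-complement-bit0Set m)) halfSize≤)
    (complement-distinct bit0Set)
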